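{- Let $M$ be a $\lambda$-term, ${\cal G}$ a graph model, $\rho:Var\to{\cal P}(G)$ an environment and $\alpha\in M^{\cal G}_\rho$. Then there exists a finite partial pair ${\cal A}\le{\cal G}$ such that $\alpha\in M^{\cal A}_{\rho\cap A}$, where $(\rho\cap A)(x)=\rho(x)\cap A$ for every variable $x$.
   Context: A partial pair is ${\cal A}=(A,c_{\cal A})$ with $A$ a set and $c_{\cal A}:A^*\times A\rightharpoonup A$ partial injective ($A^*$ = finite subsets); finite if $A$ is finite; a graph model is a partial pair with infinite carrier and total $c$. Interpretation in a partial pair: $x_\rho=\rho(x)$; $(MN)_\rho=\{\alpha\in A:\exists a\subseteq N_\rho\text{ finite},(a,\alpha)\in dom(c_{\cal A}),c_{\cal A}(a,\alpha)\in M_\rho\}$; $(\lambda x.M)_\rho=\{c_{\cal A}(a,\alpha):(a,\alpha)\in dom(c_{\cal A}),\alpha\in M_{\rho[x:=a]}\}$. ${\cal A}\le{\cal B}$ means $A\subseteq B$ and $c_{\cal B}(a,\alpha)=c_{\cal A}(a,\alpha)$ for all $(a,\alpha)\in dom(c_{\cal A})$. -}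

module Defs where

open import Level using (0ℓ)
open import Data.Nat using (ℕ; _≟_)
open import Data.List using (List)
open import Data.List.Membership.Propositional using (_∈_)
open import Data.List.Relation.Binary.Subset.Propositional using (_⊆_)
open import Data.List.Relation.Unary.All using (All)
open import Data.Product using (Σ; ∃; _×_; _,_)
open import Relation.Nullary using (¬_; yes; no)
open import Relation.Unary using (Pred)
open import Relation.Binary.PropositionalEquality using (_≡_)

Var : Set
Var = ℕ

data Term : Set where
  var : Var → Term
  app : Term → Term → Term
  lam : Var → Term → Term

-- Finite subsets of U are represented by lists, identified up to
-- having the same elements.
_≈ₛ_ : {U : Set} → List U → List U → Set
a ≈ₛ b = (a ⊆ b) × (b ⊆ a)

Finite : {U : Set} → Pred U 0ℓ → Set
Finite {U} P = ∃ λ (xs : List U) → ∀ u → (P u → u ∈ xs) × (u ∈ xs → P u)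

-- A partial pair whose carrier A is a subset of an ambient type U.
-- The partial map c : A* × A ⇀ A is given by its graph  graph a α β  ("c(a,α) = β").
record PartialPair (U : Set) : Set₁ where
  field
    carrier : Pred U 0ℓ
    graph   : List U → U → U → Set
    graph-dom  : ∀ {a α β} → graph a α β → All carrier a × carrier α × carrier β
    -- c is a function on finite subsets (independent of the list representation)
    graph-resp : ∀ {a b α β} → a ≈ₛ b → graph a α β → graph b α β
    graph-fun  : ∀ {a α β β'} → graph a α β → graph a α β' → β ≡ β'
    graph-inj  : ∀ {a b α α' β} → graph a α β → graph b α' β → (a ≈ₛ b) × (α ≡ α')

open PartialPair public

IsFinite : {U : Set} → PartialPair U → Set
IsFinite 𝒜 = Finite (carrier 𝒜)

record IsGraphModel {G : Set} (𝒢 : PartialPair G) : Set where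
  field
    full     : ∀ u → carrier 𝒢 u
    infinite : ¬ Finite (carrier 𝒢)
    total    : ∀ a α → All (carrier 𝒢) a → carrier 𝒢 α → ∃ λ β → graph 𝒢 a α β

_≤ₚ_ : {U : Set} → PartialPair U → PartialPair U → Set
𝒜 ≤ₚ ℬ = (∀ u → carrier 𝒜 u → carrier ℬ u)
       × (∀ a α β → graph 𝒜 a α β → graph ℬ a α β)

Env : Set → Set₁
Env U = Var → Pred U 0ℓ

_[_≔_] : {U : Set} → Env U → Var → List U → Env U
(ρ [ x ≔ a ]) y with x ≟ y
... | yes _ = λ u → u ∈ a
... | no  _ = ρ y

⟦_⟧ : {U : Set} → Term → PartialPair U → Env U → Pred U 0ℓ
⟦ var x ⟧   𝒜 ρ α = ρ x α
⟦ app M N ⟧ 𝒜 ρ α =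
  ∃ λ a → ∃ λ β → All (⟦ N ⟧ 𝒜 ρ) a × graph 𝒜 a α β × ⟦ M ⟧ 𝒜 ρ β
⟦ lam x M ⟧ 𝒜 ρ γ =
  ∃ λ a → ∃ λ α → graph 𝒜 a α γ × ⟦ M ⟧ 𝒜 (ρ [ x ≔ a ]) α

_∩ₑ_ : {U : Set} → Env U → Pred U 0ℓ → Env U
(ρ ∩ₑ A) x u = ρ x u × A u

{-# OPTIONS --safe #-}
module Submission where

-- A derivation of α ∈ M^𝒢_ρ uses only finitely many points of ρ (at the variables)
-- and finitely many equations c(a,α) = β of 𝒢. Record them in a finite fragment and
-- restrict c_𝒢 to the recorded outputs β: by injectivity of c_𝒢 every argument (a,α)
-- of the restricted map is then a recorded one, so the endpoints of the recorded
-- equations form the carrier of a finite partial pair 𝒜 ≤ 𝒢. Interpretation is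
-- monotone in the partial pair and the environment, so fragments for subterms merge.

open import Defs
open import Level using (0ℓ)
open import Function using (id)
open import Data.List using (List; []; _∷_; [_]; _++_; map; concatMap)
open import Data.List.Membership.Propositional using (_∈_; lose)
open import Data.List.Membership.Propositional.Properties
  using (∈-map⁺; ∈-map⁻; ∈-concatMap⁺; ∈-++⁺ʳ)
open import Data.List.Relation.Binary.Subset.Propositional using () renaming (_⊆_ to _⊆ₗ_)
open import Data.List.Relation.Binary.Subset.Propositional.Properties
  using (⊆-trans; xs⊆xs++ys; xs⊆ys++xs; ++⁺; map⁺; concatMap⁺)
open import Data.List.Relation.Unary.All as All using (All; []; _∷_)
open import Data.List.Relation.Unary.Any using (here; there)
open import Data.Nat using (_≟_)
open import Data.Product using (∃; _×_; _,_; proj₁; proj₂)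
open import Relation.Nullary using (yes; no)
open import Relation.Unary using (Pred; _⊆_)
open import Relation.Binary.PropositionalEquality using (refl)

private
  variable
    U : Set
    𝒜 ℬ : PartialPair U
    ρ ρ′ : Env U
    A B : Pred U 0ℓ
    x : Var
    a : List U

_⊆ₑ_ : Env U → Env U → Set
ρ ⊆ₑ ρ′ = ∀ y → ρ y ⊆ ρ′ y

[≔]-mono : ρ ⊆ₑ ρ′ → (ρ [ x ≔ a ]) ⊆ₑ (ρ′ [ x ≔ a ])
[≔]-mono {x = x} ρ⊆ρ′ y with x ≟ y
... | yes _ = id
... | no  _ = ρ⊆ρ′ y

∩ₑ-[≔] : A ⊆ B → ((ρ [ x ≔ a ]) ∩ₑ A) ⊆ₑ ((ρ ∩ₑ B) [ x ≔ a ])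
∩ₑ-[≔] {x = x} A⊆B y with x ≟ y
... | yes _ = proj₁
... | no  _ = λ (ρyu , Au) → ρyu , A⊆B Au

⟦⟧-mono : (M : Term) → (∀ a α β → graph 𝒜 a α β → graph ℬ a α β) →
  ρ ⊆ₑ ρ′ → ⟦ M ⟧ 𝒜 ρ ⊆ ⟦ M ⟧ ℬ ρ′
⟦⟧-mono (var x)   c⊆ ρ⊆ρ′ = ρ⊆ρ′ x
⟦⟧-mono (app M N) c⊆ ρ⊆ρ′ (a , β , Na , c[a,α]≡β , Mβ) =
  a , β , All.map (⟦⟧-mono N c⊆ ρ⊆ρ′) Na , c⊆ _ _ _ c[a,α]≡β , ⟦⟧-mono M c⊆ ρ⊆ρ′ Mβ
⟦⟧-mono (lam x M) c⊆ ρ⊆ρ′ (a , α , c[a,α]≡γ , Mα) =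
  a , α , c⊆ _ _ _ c[a,α]≡γ , ⟦⟧-mono M c⊆ ([≔]-mono {x = x} {a = a} ρ⊆ρ′) Mα

⟦⟧-∩ₑ-mono : (M : Term) → 𝒜 ≤ₚ ℬ →
  ⟦ M ⟧ 𝒜 (ρ ∩ₑ carrier 𝒜) ⊆ ⟦ M ⟧ ℬ (ρ ∩ₑ carrier ℬ)
⟦⟧-∩ₑ-mono M (A⊆B , c⊆) =
  ⟦⟧-mono M c⊆ (λ y (ρyu , Au) → ρyu , A⊆B _ Au)

⟦⟧-∩ₑ-[≔]-mono : (M : Term) → 𝒜 ≤ₚ ℬ →
  ⟦ M ⟧ 𝒜 ((ρ [ x ≔ a ]) ∩ₑ carrier 𝒜) ⊆ ⟦ M ⟧ ℬ ((ρ ∩ₑ carrier ℬ) [ x ≔ a ])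
⟦⟧-∩ₑ-[≔]-mono {ρ = ρ} {x = x} {a = a} M (A⊆B , c⊆) =
  ⟦⟧-mono M c⊆ (∩ₑ-[≔] {ρ = ρ} {x = x} {a = a} (A⊆B _))

module Fragments {G : Set} (𝒢 : PartialPair G) where

  record Edge : Set where
    constructor edge
    field
      {input}  : List G
      {arg}    : G
      {output} : G
      in-graph : graph 𝒢 input arg output

  open Edge

  endpoints : Edge → List G
  endpoints e = output e ∷ arg e ∷ input e

  record Fragment : Set where
    constructor fragment
    field
      points : List G
      edges  : List Edge

  open Fragment

  support : Fragment → List G
  support d = points d ++ concatMap endpoints (edges d)

  endpoints⊆support : ∀ {e d} → e ∈ edges d → endpoints e ⊆ₗ support d
  endpoints⊆support {d = d} e∈ u∈ = ∈-++⁺ʳ (points d) (∈-concatMap⁺ endpoints (lose e∈ u∈))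

  restrict : Fragment → PartialPair G
  restrict d = record
    { carrier    = _∈ support d
    -- keyed on the output alone, so graph-resp is inherited from 𝒢 even though
    -- the recorded argument list is only one representative of a finite set
    ; graph      = λ a α β → graph 𝒢 a α β × β ∈ map output (edges d)
    ; graph-dom  = dom
    ; graph-resp = λ a≈b (c[a,α]≡β , β∈) → graph-resp 𝒢 a≈b c[a,α]≡β , β∈
    ; graph-fun  = λ (c[a,α]≡β , _) (c[a,α]≡β′ , _) → graph-fun 𝒢 c[a,α]≡β c[a,α]≡β′
    ; graph-inj  = λ (c[a,α]≡β , _) (c[b,α′]≡β , _) → graph-inj 𝒢 c[a,α]≡β c[b,α′]≡β
    }
    where
    dom : ∀ {a α β} → graph 𝒢 a α β × β ∈ map output (edges d) →
      All (_∈ support d) a × α ∈ support d × β ∈ support d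
    dom (c[a,α]≡β , β∈) with ∈-map⁻ output β∈
    ... | e , e∈ , refl with graph-inj 𝒢 c[a,α]≡β (in-graph e)
    ...   | (a⊆input , _) , refl =
      All.tabulate (λ u∈a → e⊆support (there (there (a⊆input u∈a)))) ,
      e⊆support (there (here refl)) ,
      e⊆support (here refl)
      where
      e⊆support : endpoints e ⊆ₗ support d
      e⊆support = endpoints⊆support e∈

  restrict-finite : ∀ d → IsFinite (restrict d)
  restrict-finite d = support d , λ _ → id , id

  restrict-≤ : (∀ u → carrier 𝒢 u) → ∀ d → restrict d ≤ₚ 𝒢
  restrict-≤ full d = (λ u _ → full u) , (λ _ _ _ → proj₁)

  edge∈graph : ∀ e d → e ∈ edges d → graph (restrict d) (input e) (arg e) (output e)
  edge∈graph e d e∈ = in-graph e , ∈-map⁺ output e∈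

  infix 4 _⊑_
  infixr 5 _⊕_

  _⊑_ : Fragment → Fragment → Set
  d ⊑ d′ = points d ⊆ₗ points d′ × edges d ⊆ₗ edges d′

  ⊑-trans : ∀ {d d′ d″} → d ⊑ d′ → d′ ⊑ d″ → d ⊑ d″
  ⊑-trans (p , q) (p′ , q′) = ⊆-trans p p′ , ⊆-trans q q′

  restrict-mono : ∀ {d d′} → d ⊑ d′ → restrict d ≤ₚ restrict d′
  restrict-mono (p , q) =
    (λ _ → ++⁺ p (concatMap⁺ endpoints q)) ,
    (λ _ _ _ (c[a,α]≡β , β∈) → c[a,α]≡β , map⁺ output q β∈)

  ∅ : Fragment
  ∅ = fragment [] []

  single : Edge → Fragment
  single e = fragment [] [ e ]

  _⊕_ : Fragment → Fragment → Fragment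
  d ⊕ d′ = fragment (points d ++ points d′) (edges d ++ edges d′)

  ⊑-⊕ˡ : ∀ d d′ → d ⊑ d ⊕ d′
  ⊑-⊕ˡ d d′ = xs⊆xs++ys (points d) (points d′) , xs⊆xs++ys (edges d) (edges d′)

  ⊑-⊕ʳ : ∀ d d′ → d′ ⊑ d ⊕ d′
  ⊑-⊕ʳ d d′ = xs⊆ys++xs (points d′) (points d) , xs⊆ys++xs (edges d′) (edges d)

  module _ (P : Fragment → Pred G 0ℓ) (P-mono : ∀ {d d′} → d ⊑ d′ → P d ⊆ P d′) where

    common-fragment : ∀ (a : List G) → All (λ u → ∃ λ d → P d u) a → ∃ λ d → All (P d) a
    common-fragment []      []                = ∅ , []
    common-fragment (_ ∷ a) ((d , Pdu) ∷ Pa) with common-fragment a Pa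
    ... | d′ , Pd′a = d ⊕ d′ , P-mono (⊑-⊕ˡ d d′) Pdu ∷ All.map (P-mono (⊑-⊕ʳ d d′)) Pd′a

  ⟦_⟧ᶠ : Term → Fragment → Env G → Pred G 0ℓ
  ⟦ M ⟧ᶠ d ρ = ⟦ M ⟧ (restrict d) (ρ ∩ₑ carrier (restrict d))

  ⟦⟧ᶠ-mono : ∀ M {ρ d d′} → d ⊑ d′ → ⟦ M ⟧ᶠ d ρ ⊆ ⟦ M ⟧ᶠ d′ ρ
  ⟦⟧ᶠ-mono M d⊑d′ = ⟦⟧-∩ₑ-mono M (restrict-mono d⊑d′)

  approximate : ∀ M {ρ α} → ⟦ M ⟧ 𝒢 ρ α → ∃ λ d → ⟦ M ⟧ᶠ d ρ α
  approximate (var x) {α = α} ρxα = fragment [ α ] [] , ρxα , here refl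
  approximate (app M N) {ρ} (a , β , Na , c[a,α]≡β , Mβ) with approximate M Mβ
      | common-fragment (λ d → ⟦ N ⟧ᶠ d ρ) (⟦⟧ᶠ-mono N) a (All.map (approximate N) Na)
  ... | d₁ , Mβ′ | d₂ , Na′ =
    d , a , β , All.map (⟦⟧ᶠ-mono N d₂⊑d) Na′ , edge∈graph e d (here refl) , ⟦⟧ᶠ-mono M d₁⊑d Mβ′
    where
    e : Edge
    e = edge c[a,α]≡β
    d : Fragment
    d = single e ⊕ d₁ ⊕ d₂
    d₁⊑d : d₁ ⊑ d
    d₁⊑d = ⊑-trans (⊑-⊕ˡ d₁ d₂) (⊑-⊕ʳ (single e) (d₁ ⊕ d₂))
    d₂⊑d : d₂ ⊑ d
    d₂⊑d = ⊑-trans (⊑-⊕ʳ d₁ d₂) (⊑-⊕ʳ (single e) (d₁ ⊕ d₂))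
  approximate (lam x M) {ρ} (a , α , c[a,α]≡γ , Mα) with approximate M Mα
  ... | d₁ , Mα′ =
    d , a , α , edge∈graph e d (here refl) ,
    ⟦⟧-∩ₑ-[≔]-mono {ρ = ρ} {x = x} {a = a} M (restrict-mono d₁⊑d) Mα′
    where
    e : Edge
    e = edge c[a,α]≡γ
    d : Fragment
    d = single e ⊕ d₁
    d₁⊑d : d₁ ⊑ d
    d₁⊑d = ⊑-⊕ʳ (single e) d₁

lemma4 : {G : Set} (M : Term) (𝒢 : PartialPair G) → IsGraphModel 𝒢 →
    (ρ : Env G) (α : G) → ⟦ M ⟧ 𝒢 ρ α →
    ∃ λ (𝒜 : PartialPair G) →
      IsFinite 𝒜 × (𝒜 ≤ₚ 𝒢) × ⟦ M ⟧ 𝒜 (ρ ∩ₑ carrier 𝒜) α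
lemma4 M 𝒢 𝒢-graph-model ρ α Mα =
  let d , Mα′ = approximate M Mα
  in restrict d , restrict-finite d , restrict-≤ (IsGraphModel.full 𝒢-graph-model) d , Mα′
  where open Fragments 𝒢
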